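{- Let $\mathcal{P} = \langle P, \preceq \rangle$ be a (non-strict) partially ordered set, considered in the language $\{\preceq, =\}$ with a constant symbol for every element of $P$. The following are equivalent: (1) $\mathcal{P}$ is not equationally Noetherian; (2) $\mathcal{P}$ contains a $\preceq$-perfectly non-Noetherian substructure; (3) there is a subset $B \subseteq P$ whose upper base cone or lower base cone is infinitely generated.
   Context: $\mathcal{P}$ is equationally Noetherian if for every finite set of variables $X$, every system of equations (atomic formulas $w_1 \preceq w_2$ or $w_1 = w_2$ with $w_i$ variables or constants) has the same solution set as some finite subsystem. $\mathcal{P}$ contains a $\preceq$-perfectly non-Noetherian substructure if there are sequences $(a_i)_{i\in\mathbb{N}}$, $(b_i)_{i\in\mathbb{N}}$ of elements of $P$, all elements $a_1,b_1,a_2,b_2,\dots$ pairwise different, such that either ($a_i \not\preceq b_i$ for all $i$ and $a_i \preceq b_j$ for all $j<i$) or ($b_i \not\preceq a_i$ for all $i$ and $b_j \preceq a_i$ for all $j<i$). For $B \subseteq P$ let $B^{\uparrow} = \{x : b \preceq x \ \forall b \in B\}$ and $B^{\downarrow} = \{x : x \preceq b\ \forall b\in B\}$. The upper base cone $(B, B^\uparrow)$ is finitely generated if some finite $B_0 \subseteq B$ has $B_0^\uparrow = B^\uparrow$, and infinitely generated otherwise; similarly for the lower base cone with $\downarrow$. -}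

module Defs where

open import Level using (0ℓ)
open import Data.Nat using (ℕ; _<_)
open import Data.Fin using (Fin)
open import Data.List using (List)
open import Data.List.Relation.Unary.All using (All)
open import Data.Product using (Σ; _×_; ∃)
open import Data.Sum using (_⊎_)
open import Relation.Nullary using (¬_)
open import Relation.Unary using (Pred)
open import Relation.Binary.PropositionalEquality using (_≡_; _≢_)
open import Function.Bundles using (_⇔_)

-- Everything is relative to a carrier P with a binary relation _≼_
-- (the partial-order hypothesis is imposed in the statement).
module _ {P : Set} (_≼_ : P → P → Set) where

  data Term (n : ℕ) : Set where
    var : Fin n → Term n
    con : P → Term n

  data Eqn (n : ℕ) : Set where
    _≼ₑ_ : Term n → Term n → Eqn n
    _=ₑ_ : Term n → Term n → Eqn n

  eval : ∀ {n} → (Fin n → P) → Term n → P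
  eval σ (var x) = σ x
  eval σ (con c) = c

  Sat : ∀ {n} → (Fin n → P) → Eqn n → Set
  Sat σ (u ≼ₑ v) = eval σ u ≼ eval σ v
  Sat σ (u =ₑ v) = eval σ u ≡ eval σ v

  Solution : ∀ {n} → Pred (Eqn n) 0ℓ → (Fin n → P) → Set
  Solution S σ = ∀ e → S e → Sat σ e

  EquationallyNoetherian : Set₁
  EquationallyNoetherian =
    ∀ (n : ℕ) (S : Pred (Eqn n) 0ℓ) →
      Σ (List (Eqn n)) λ S₀ →
        All S S₀ × (∀ σ → Solution S σ ⇔ All (Sat σ) S₀)

  PerfectlyNonNoetherian : Set
  PerfectlyNonNoetherian =
    Σ (ℕ → P) λ a → Σ (ℕ → P) λ b →
      (∀ i j → i ≢ j → a i ≢ a j) ×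
      (∀ i j → i ≢ j → b i ≢ b j) ×
      (∀ i j → a i ≢ b j) ×
      ( ((∀ i → ¬ (a i ≼ b i)) × (∀ i j → j < i → a i ≼ b j))
      ⊎ ((∀ i → ¬ (b i ≼ a i)) × (∀ i j → j < i → b j ≼ a i)) )

  Up : Pred P 0ℓ → Pred P 0ℓ
  Up B x = ∀ b → B b → b ≼ x

  Down : Pred P 0ℓ → Pred P 0ℓ
  Down B x = ∀ b → B b → x ≼ b

  UpL : List P → Pred P 0ℓ
  UpL B₀ x = All (λ b → b ≼ x) B₀

  DownL : List P → Pred P 0ℓ
  DownL B₀ x = All (λ b → x ≼ b) B₀

  UpperConeFinGen : Pred P 0ℓ → Set
  UpperConeFinGen B =
    Σ (List P) λ B₀ → All B B₀ × (∀ x → UpL B₀ x ⇔ Up B x)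

  LowerConeFinGen : Pred P 0ℓ → Set
  LowerConeFinGen B =
    Σ (List P) λ B₀ → All B B₀ × (∀ x → DownL B₀ x ⇔ Down B x)

  HasInfGenBaseCone : Set₁
  HasInfGenBaseCone =
    Σ (Pred P 0ℓ) λ B → ¬ UpperConeFinGen B ⊎ ¬ LowerConeFinGen B

-- Of the equations in variables x₁ … xₙ, those between two variables are finitely many,
-- those between two constants are either all true or contain a false one, and those of
-- the forms x ≼ c, c ≼ x, x = c, c = x say that x lies in a lower or upper cone of a set
-- of constants. So if all base cones are finitely generated, every system is equivalent
-- to a finite subsystem; conversely the one-variable systems {x ≼ c | c ∈ B} are cones.
-- A perfectly non-Noetherian chain gives the infinitely generated cone of {bⱼ}: aₘ lies in
-- the cone of b₀ … bₘ₋₁ but not in that of bₘ. Conversely, from an infinitely generated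
-- cone of B a chain is built greedily: aᵢ is in the cone of the finitely many elements of
-- B chosen so far but not in that of B, bᵢ ∈ B witnesses this, and a few more elements of
-- B are chosen so that all later aₖ stay distinct from aᵢ and bᵢ.
module Submission where

open import Defs
open import Level using (0ℓ)
open import Data.Product using (_×_)
open import Relation.Nullary using (¬_)
open import Relation.Binary.PropositionalEquality using (_≡_)
open import Relation.Binary.Structures using (IsPartialOrder)
open import Function.Bundles using (_⇔_)
open import Axiom.ExcludedMiddle using (ExcludedMiddle)

open import Axiom.DoubleNegationElimination using (em⇒dne)
open import Data.Empty using (⊥-elim)
open import Data.Fin using (Fin) renaming (zero to fzero; suc to fsuc)
open import Data.List using (List; []; _∷_; _++_; map)
open import Data.List.Extrema.Nat using (max; xs≤max)
open import Data.List.Relation.Unary.All as All using (All; []; _∷_)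
open import Data.List.Relation.Unary.All.Properties using (++⁺; ++⁻ˡ; ++⁻ʳ; map⁺; map⁻)
open import Data.Nat using (ℕ; zero; suc; _<_; s≤s)
open import Data.Nat.Properties using (<-cmp; m<1+n⇒m<n∨m≡n)
open import Data.Product using (Σ; ∃; _,_; proj₁; proj₂)
open import Data.Sum using (inj₁; inj₂)
open import Function using (flip; _∘_)
open import Function.Bundles using (mk⇔; Equivalence)
open import Relation.Binary.Definitions using (tri<; tri≈; tri>)
open import Relation.Binary.PropositionalEquality using (_≢_; refl; sym; subst)
open import Relation.Nullary using (Dec; yes; no)
open import Relation.Unary using (Pred; _∩_)

Range : {I A : Set} → (I → A) → Pred A 0ℓ
Range f x = ∃ λ i → f i ≡ x

All-Range⇒map : {I A : Set} {f : I → A} {xs : List A} →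
                All (Range f) xs → ∃ λ is → map f is ≡ xs
All-Range⇒map [] = [] , refl
All-Range⇒map ((i , refl) ∷ rs) with All-Range⇒map rs
... | is , refl = i ∷ is , refl

<-distinct⇒injective : {A : Set} {f : ℕ → A} → (∀ {i j} → j < i → f i ≢ f j) →
                       ∀ i j → i ≢ j → f i ≢ f j
<-distinct⇒injective h i j i≢j with <-cmp i j
... | tri< i<j _ _ = h i<j ∘ sym
... | tri≈ _ i≡j _ = ⊥-elim (i≢j i≡j)
... | tri> _ _ j<i = h j<i

module Forcing {E X : Set} (_⊨_ : X → E → Set) (S : Pred E 0ℓ) where

  Forces : Pred X 0ℓ → Set
  Forces Q = Σ (List E) λ T → All S T × (∀ x → All (x ⊨_) T → Q x)

  Models : Pred X 0ℓ
  Models x = ∀ e → S e → x ⊨ e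

  All-models : ∀ {T x} → All S T → Models x → All (x ⊨_) T
  All-models T⊆S m = All.map (m _) T⊆S

  forces-single : ∀ {e} → S e → Forces (_⊨ e)
  forces-single {e} s = e ∷ [] , s ∷ [] , λ { _ (x⊨e ∷ []) → x⊨e }

  forces-map : ∀ {Q Q′ : Pred X 0ℓ} → (∀ {x} → Q x → Q′ x) → Forces Q → Forces Q′
  forces-map f (T , T⊆S , h) = T , T⊆S , λ x → f ∘ h x

  forces-∩ : ∀ {Q Q′ : Pred X 0ℓ} → Forces Q → Forces Q′ → Forces (Q ∩ Q′)
  forces-∩ (T , T⊆S , h) (T′ , T′⊆S , h′) =
    T ++ T′ , ++⁺ T⊆S T′⊆S , λ x x⊨ → h x (++⁻ˡ T x⊨) , h′ x (++⁻ʳ T x⊨)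

  forces-if : ∀ {A : Set} {Q : Pred X 0ℓ} → Dec A → (A → Forces Q) → Forces (λ x → A → Q x)
  forces-if (yes a) f = forces-map (λ q _ → q) (f a)
  forces-if (no ¬a) _ = [] , [] , λ _ _ a → ⊥-elim (¬a a)

  forces-∀Fin : ∀ {n} {Q : Fin n → Pred X 0ℓ} → (∀ i → Forces (Q i)) → Forces (λ x → ∀ i → Q i x)
  forces-∀Fin {zero} _ = [] , [] , λ _ _ ()
  forces-∀Fin {suc n} f =
    forces-map (λ { (q₀ , q) → λ { fzero → q₀ ; (fsuc i) → q i } })
               (forces-∩ (f fzero) (forces-∀Fin (f ∘ fsuc)))

  module _ (lem : ExcludedMiddle 0ℓ) where

    forces-member : ∀ e → Forces (λ x → S e → x ⊨ e)
    forces-member e = forces-if lem forces-single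

    counterexample : ∀ {x} → ¬ Models x → ∃ λ e → S e × ¬ x ⊨ e
    counterexample ¬m =
      em⇒dne lem λ ∄ → ¬m λ e s → em⇒dne lem λ ¬x⊨e → ∄ (e , s , ¬x⊨e)

    forces-≢ : ∀ {x₀} → ¬ Models x₀ → Forces (_≢ x₀)
    forces-≢ ¬m with counterexample ¬m
    ... | e , s , ¬x₀⊨e = forces-map (λ { x⊨e refl → ¬x₀⊨e x⊨e }) (forces-single s)

    escape : ∀ {Q : Pred X 0ℓ} → ¬ Forces Q → ∀ {T} → All S T → ∃ λ x → All (x ⊨_) T × ¬ Q x
    escape ¬f {T} T⊆S =
      em⇒dne lem λ ∄ → ¬f (T , T⊆S , λ x x⊨T → em⇒dne lem λ ¬q → ∄ (x , x⊨T , ¬q))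

    -- Either a member of the family in S is false, and it alone forces anything, or none is.
    forces-closed : {I : Set} (g : I → E) → (∀ {x y i} → x ⊨ g i → y ⊨ g i) →
                    Forces (λ x → ∀ i → S (g i) → x ⊨ g i)
    forces-closed g closed with lem {∃ λ i → S (g i) × ¬ (∀ x → x ⊨ g i)}
    ... | yes (i , s , ¬all) = forces-map (λ x⊨ → ⊥-elim (¬all λ _ → closed x⊨)) (forces-single s)
    ... | no ∄ = [] , [] , λ x _ i s → em⇒dne lem λ ¬x⊨ → ∄ (i , s , λ all → ¬x⊨ (all x))

forces-comap : {E E′ X X′ : Set} {_⊨_ : X → E → Set} {_⊨′_ : X′ → E′ → Set} {S : Pred E 0ℓ}
               {Q : Pred X′ 0ℓ} (f : E′ → E) (π : X → X′) → (∀ {x e′} → x ⊨ f e′ → π x ⊨′ e′) →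
               Forcing.Forces _⊨′_ (S ∘ f) Q → Forcing.Forces _⊨_ S (Q ∘ π)
forces-comap f π sat (T , T⊆S , h) =
  map f T , map⁺ T⊆S , λ x x⊨ → h (π x) (All.map sat (map⁻ x⊨))

module Cones {P : Set} (R : P → P → Set) where

  LowerConeFinGen⇒Forces : ∀ {B} → LowerConeFinGen R B → Forcing.Forces R B (Forcing.Models R B)
  LowerConeFinGen⇒Forces (B₀ , B₀⊆B , gen) = B₀ , B₀⊆B , λ x → Equivalence.to (gen x)

  Forces⇒LowerConeFinGen : ∀ {B} → Forcing.Forces R B (Forcing.Models R B) → LowerConeFinGen R B
  Forces⇒LowerConeFinGen (B₀ , B₀⊆B , h) =
    B₀ , B₀⊆B , λ x → mk⇔ (h x) (Forcing.All-models R _ B₀⊆B)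

  -- Upper cones for R are lower cones for flip R, so only lower cones are treated; the two
  -- alternatives of a perfectly non-Noetherian substructure are Chain R and Chain (flip R).
  Chain : (ℕ → P) → (ℕ → P) → Set
  Chain a b = (∀ i → ¬ R (a i) (b i)) × (∀ i j → j < i → R (a i) (b j))

  PerfectChain : Set
  PerfectChain = Σ (ℕ → P) λ a → Σ (ℕ → P) λ b →
    (∀ i j → i ≢ j → a i ≢ a j) × (∀ i j → i ≢ j → b i ≢ b j) × (∀ i j → a i ≢ b j) × Chain a b

  chain-injectiveˡ : ∀ {a b} → Chain a b → ∀ i j → i ≢ j → a i ≢ a j
  chain-injectiveˡ {a} {b} (a≰b , a≤b) =
    <-distinct⇒injective λ {i} {j} j<i ai≡aj → a≰b j (subst (λ x → R x (b j)) ai≡aj (a≤b i j j<i))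

  chain-injectiveʳ : ∀ {a b} → Chain a b → ∀ i j → i ≢ j → b i ≢ b j
  chain-injectiveʳ {a} {b} (a≰b , a≤b) =
    <-distinct⇒injective λ {i} {j} j<i bi≡bj → a≰b i (subst (R (a i)) (sym bi≡bj) (a≤b i j j<i))

  chain⇒¬LowerConeFinGen : ∀ {a b} → Chain a b → ¬ LowerConeFinGen R (Range b)
  chain⇒¬LowerConeFinGen {a} {b} (a≰b , a≤b) (B₀ , B₀⊆b , gen) with All-Range⇒map B₀⊆b
  ... | js , refl = a≰b m (Equivalence.to (gen (a m)) below (b m) (m , refl))
    where
    m : ℕ
    m = suc (max 0 js)
    below : All (R (a m)) (map b js)
    below = map⁺ (All.map (λ j≤max → a≤b m _ (s≤s j≤max)) (xs≤max 0 js))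

module ChainConstruction (lem : ExcludedMiddle 0ℓ) {P : Set} (R : P → P → Set)
                         (R-refl : ∀ {x} → R x x) {B : Pred P 0ℓ}
                         (¬fg : ¬ LowerConeFinGen R B) where
  open Forcing R B
  open Cones R

  Stage : Set
  Stage = Σ (List P) (All B)

  -- Once a stage contains the elements forcing Pinned y, no later aₖ can equal y unless
  -- y lies in the cone of B, and aₖ lies below y when y ∈ B.
  Pinned : P → Pred P 0ℓ
  Pinned y z = (B y → R z y) × (¬ Models y → z ≢ y)

  pin : ∀ y → Forces (Pinned y)
  pin y = forces-∩ (forces-if lem forces-single) (forces-if lem (forces-≢ lem))

  escaping : (G : Stage) → ∃ λ a → All (R a) (proj₁ G) × ¬ Models a
  escaping (_ , G⊆B) = escape lem (¬fg ∘ Forces⇒LowerConeFinGen) G⊆B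

  escapee : Stage → P
  escapee G = proj₁ (escaping G)

  escapee-escapes : ∀ G → ¬ Models (escapee G)
  escapee-escapes G = proj₂ (proj₂ (escaping G))

  witness : Stage → P
  witness G = proj₁ (counterexample lem (escapee-escapes G))

  witness∈B : ∀ G → B (witness G)
  witness∈B G = proj₁ (proj₂ (counterexample lem (escapee-escapes G)))

  pins : (G : Stage) → Forces (Pinned (escapee G) ∩ Pinned (witness G))
  pins G = forces-∩ (pin (escapee G)) (pin (witness G))

  next : Stage → Stage
  next G = proj₁ (pins G) ++ proj₁ G , ++⁺ (proj₁ (proj₂ (pins G))) (proj₂ G)

  stage : ℕ → Stage
  stage zero = [] , []
  stage (suc i) = next (stage i)

  a b : ℕ → P
  a = escapee ∘ stage
  b = witness ∘ stage

  stage-pins : ∀ {j i z} → j < i → All (R z) (proj₁ (stage i)) → (Pinned (a j) ∩ Pinned (b j)) z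
  stage-pins {j} {suc i} j<1+i z⊨ with m<1+n⇒m<n∨m≡n j<1+i
  ... | inj₁ j<i = stage-pins j<i (++⁻ʳ (proj₁ (pins (stage i))) z⊨)
  ... | inj₂ refl = proj₂ (proj₂ (pins (stage j))) _ (++⁻ˡ _ z⊨)

  later : ∀ {j i} → j < i → (Pinned (a j) ∩ Pinned (b j)) (a i)
  later {i = i} j<i = stage-pins j<i (proj₁ (proj₂ (escaping (stage i))))

  chain : Chain a b
  chain = (λ i → proj₂ (proj₂ (counterexample lem (escapee-escapes (stage i)))))
        , λ i j j<i → proj₁ (proj₂ (later j<i)) (witness∈B (stage j))

  a≢b : ∀ i j → a i ≢ b j
  a≢b i j ai≡bj with <-cmp i j
  ... | tri< i<j _ _ =
    proj₁ chain j (subst (R (a j)) ai≡bj (proj₁ (proj₁ (later i<j)) (subst B (sym ai≡bj) (witness∈B (stage j)))))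
  ... | tri≈ _ refl _ = proj₁ chain i (subst (R (a i)) ai≡bj R-refl)
  ... | tri> _ _ j<i =
    proj₂ (proj₂ (later j<i)) (subst (¬_ ∘ Models) ai≡bj (escapee-escapes (stage i))) ai≡bj

  perfectChain : PerfectChain
  perfectChain = a , b , chain-injectiveˡ chain , chain-injectiveʳ chain , a≢b , chain

module Solutions (lem : ExcludedMiddle 0ℓ) {P : Set} {_≼_ : P → P → Set}
                 (po : IsPartialOrder _≡_ _≼_)
                 (lower : ∀ B → LowerConeFinGen _≼_ B) (upper : ∀ B → UpperConeFinGen _≼_ B)
                 {n : ℕ} (S : Pred (Eqn _≼_ n) 0ℓ) where
  open IsPartialOrder po using (antisym; reflexive)
  open Forcing (Sat _≼_) S

  Assignment : Set
  Assignment = Fin n → P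

  Holds : Eqn _≼_ n → Pred Assignment 0ℓ
  Holds e σ = S e → Sat _≼_ σ e

  VarVar ConCon VarCon : Pred Assignment 0ℓ
  VarVar σ = ∀ x y → Holds (var x ≼ₑ var y) σ × Holds (var x =ₑ var y) σ
  ConCon σ = (∀ (cd : P × P) → Holds (con (proj₁ cd) ≼ₑ con (proj₂ cd)) σ)
           × (∀ (cd : P × P) → Holds (con (proj₁ cd) =ₑ con (proj₂ cd)) σ)
  VarCon σ = ∀ x → (∀ c → Holds (var x ≼ₑ con c) σ) × (∀ c → Holds (con c ≼ₑ var x) σ)
                 × (∀ c → Holds (var x =ₑ con c) σ) × (∀ c → Holds (con c =ₑ var x) σ)

  var-var : Forces VarVar
  var-var = forces-∀Fin λ x → forces-∀Fin λ y → forces-∩ (forces-member lem _) (forces-member lem _)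

  con-con : Forces ConCon
  con-con = forces-∩ (forces-closed lem (λ (c , d) → con c ≼ₑ con d) (λ c≼d → c≼d))
                     (forces-closed lem (λ (c , d) → con c =ₑ con d) (λ c≡d → c≡d))

  cone : (R : P → P → Set) → (∀ B → LowerConeFinGen R B) → (x : Fin n) (f : P → Eqn _≼_ n) →
         (∀ {σ c} → Sat _≼_ σ (f c) → R (σ x) c) → Forces (λ σ → ∀ c → S (f c) → R (σ x) c)
  cone R fg x f sat⇒R = forces-comap f (λ σ → σ x) sat⇒R (Cones.LowerConeFinGen⇒Forces R (fg _))

  pinned : (x : Fin n) (f : P → Eqn _≼_ n) → (∀ {σ c} → Sat _≼_ σ (f c) → σ x ≡ c) →
           (∀ {σ c} → σ x ≡ c → Sat _≼_ σ (f c)) → Forces (λ σ → ∀ c → Holds (f c) σ)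
  pinned x f to from =
    forces-map (λ (below , above) c s → from (antisym (below c s) (above c s)))
               (forces-∩ (cone _≼_ lower x f (reflexive ∘ to))
                         (cone (flip _≼_) upper x f (reflexive ∘ sym ∘ to)))

  var-con : Forces VarCon
  var-con = forces-∀Fin λ x →
    forces-∩ (cone _≼_ lower x (λ c → var x ≼ₑ con c) (λ σx≼c → σx≼c))
    (forces-∩ (cone (flip _≼_) upper x (λ c → con c ≼ₑ var x) (λ c≼σx → c≼σx))
    (forces-∩ (pinned x (λ c → var x =ₑ con c) (λ σx≡c → σx≡c) (λ σx≡c → σx≡c))
              (pinned x (λ c → con c =ₑ var x) sym sym)))

  assemble : ∀ {σ} → (VarVar ∩ ConCon ∩ VarCon) σ → Solution _≼_ S σ
  assemble (vv , cc , vc) (var x ≼ₑ var y) = proj₁ (vv x y)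
  assemble (vv , cc , vc) (var x =ₑ var y) = proj₂ (vv x y)
  assemble (vv , cc , vc) (con c ≼ₑ con d) = proj₁ cc (c , d)
  assemble (vv , cc , vc) (con c =ₑ con d) = proj₂ cc (c , d)
  assemble (vv , cc , vc) (var x ≼ₑ con c) = proj₁ (vc x) c
  assemble (vv , cc , vc) (con c ≼ₑ var x) = proj₁ (proj₂ (vc x)) c
  assemble (vv , cc , vc) (var x =ₑ con c) = proj₁ (proj₂ (proj₂ (vc x))) c
  assemble (vv , cc , vc) (con c =ₑ var x) = proj₂ (proj₂ (proj₂ (vc x))) c

  solutions : Forces (Solution _≼_ S)
  solutions = forces-map assemble (forces-∩ var-var (forces-∩ con-con var-con))

module _ {P : Set} {_≼_ : P → P → Set} where

  cones⇒EquationallyNoetherian : ExcludedMiddle 0ℓ → IsPartialOrder _≡_ _≼_ →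
    (∀ B → LowerConeFinGen _≼_ B) → (∀ B → UpperConeFinGen _≼_ B) → EquationallyNoetherian _≼_
  cones⇒EquationallyNoetherian lem po lower upper n S with Solutions.solutions lem po lower upper S
  ... | T , T⊆S , forced = T , T⊆S , λ σ → mk⇔ (Forcing.All-models (Sat _≼_) S T⊆S) (forced σ)

  EquationallyNoetherian⇒LowerConeFinGen : EquationallyNoetherian _≼_ →
    (R : P → P → Set) (f : P → Eqn _≼_ 1) →
    (∀ {z c} → R z c → Sat _≼_ (λ _ → z) (f c)) → (∀ {z c} → Sat _≼_ (λ _ → z) (f c) → R z c) →
    ∀ B → LowerConeFinGen R B
  EquationallyNoetherian⇒LowerConeFinGen en R f from to B with en 1 (Range (f ∘ proj₁ {B = B}))
  ... | T , T⊆S , gen with All-Range⇒map T⊆S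
  ... | cs , refl = Cones.Forces⇒LowerConeFinGen R
    ( map proj₁ cs , map⁺ (All.universal proj₂ cs)
    , λ z z⊨ c c∈B → to (Equivalence.from (gen (λ _ → z)) (map⁺ (All.map from (map⁻ z⊨)))
                                           (f c) ((c , c∈B) , refl)))

  EquationallyNoetherian⇒¬HasInfGenBaseCone : EquationallyNoetherian _≼_ → ¬ HasInfGenBaseCone _≼_
  EquationallyNoetherian⇒¬HasInfGenBaseCone en (B , inj₁ ¬upper) =
    ¬upper (EquationallyNoetherian⇒LowerConeFinGen en (flip _≼_) (λ c → con c ≼ₑ var fzero)
              (λ c≼z → c≼z) (λ c≼z → c≼z) B)
  EquationallyNoetherian⇒¬HasInfGenBaseCone en (B , inj₂ ¬lower) =
    ¬lower (EquationallyNoetherian⇒LowerConeFinGen en _≼_ (λ c → var fzero ≼ₑ con c)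
              (λ z≼c → z≼c) (λ z≼c → z≼c) B)

  PerfectlyNonNoetherian⇒HasInfGenBaseCone : PerfectlyNonNoetherian _≼_ → HasInfGenBaseCone _≼_
  PerfectlyNonNoetherian⇒HasInfGenBaseCone (_ , b , _ , _ , _ , inj₁ chain) =
    Range b , inj₂ (Cones.chain⇒¬LowerConeFinGen _≼_ chain)
  PerfectlyNonNoetherian⇒HasInfGenBaseCone (_ , b , _ , _ , _ , inj₂ chain) =
    Range b , inj₁ (Cones.chain⇒¬LowerConeFinGen (flip _≼_) chain)

  HasInfGenBaseCone⇒PerfectlyNonNoetherian : ExcludedMiddle 0ℓ → (∀ {x} → x ≼ x) →
    HasInfGenBaseCone _≼_ → PerfectlyNonNoetherian _≼_
  HasInfGenBaseCone⇒PerfectlyNonNoetherian lem ≼-refl (_ , inj₁ ¬upper)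
    with ChainConstruction.perfectChain lem (flip _≼_) ≼-refl ¬upper
  ... | a , b , a-inj , b-inj , a≢b , chain = a , b , a-inj , b-inj , a≢b , inj₂ chain
  HasInfGenBaseCone⇒PerfectlyNonNoetherian lem ≼-refl (_ , inj₂ ¬lower)
    with ChainConstruction.perfectChain lem _≼_ ≼-refl ¬lower
  ... | a , b , a-inj , b-inj , a≢b , chain = a , b , a-inj , b-inj , a≢b , inj₁ chain

proposition4p4 : ExcludedMiddle 0ℓ → ExcludedMiddle (Level.suc 0ℓ) →
    (P : Set) (_≼_ : P → P → Set) → IsPartialOrder _≡_ _≼_ →
    ((¬ EquationallyNoetherian _≼_) ⇔ PerfectlyNonNoetherian _≼_)
    × (PerfectlyNonNoetherian _≼_ ⇔ HasInfGenBaseCone _≼_)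
proposition4p4 lem _ _ _≼_ po =
  mk⇔ ¬EN⇒PNN (λ pnn en → EquationallyNoetherian⇒¬HasInfGenBaseCone en (PNN⇒HIG pnn)) ,
  mk⇔ PNN⇒HIG HIG⇒PNN
  where
  PNN⇒HIG = PerfectlyNonNoetherian⇒HasInfGenBaseCone
  HIG⇒PNN = HasInfGenBaseCone⇒PerfectlyNonNoetherian lem (IsPartialOrder.refl po)

  ¬EN⇒PNN : ¬ EquationallyNoetherian _≼_ → PerfectlyNonNoetherian _≼_
  ¬EN⇒PNN ¬en = em⇒dne lem λ ¬pnn → ¬en (cones⇒EquationallyNoetherian lem po
    (λ B → em⇒dne lem λ ¬lower → ¬pnn (HIG⇒PNN (B , inj₂ ¬lower)))
    (λ B → em⇒dne lem λ ¬upper → ¬pnn (HIG⇒PNN (B , inj₁ ¬upper))))
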